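{- For $n\ge1$ and $k\ge1$, the number of type $B$ merging-free separated set partitions of $\langle n\rangle$ without zero block having $k$ blocks equals the number of type $B$ set partitions of $\langle n-1\rangle$ without zero block having exactly $k-1$ non-singleton blocks.
   Context: $\langle n\rangle=\{0,\pm1,\dots,\pm n\}$, $[n]=\{1,\dots,n\}$. A type $B$ set partition of $\langle n\rangle$ without zero block is encoded as $\pi=\pi_1\mid\cdots\mid\pi_k$: nonempty sets of nonzero integers with the sets $|\pi_i|=\{|a|:a\in\pi_i\}$ partitioning $[n]$, the element of smallest absolute value $m_i$ of $\pi_i$ positive, $m_1<\cdots<m_k$; $k$ is its number of blocks, and a block is a singleton if it has exactly one element. It is merging-free if there is no $i\in\{2,\dots,k\}$ with $\max|\pi_{i-1}|<m_i$. An $a\in\{2,\dots,n\}$ is a succession if $a-1,a$ lie in the same block or $-(a-1),-a$ lie in the same block; the partition is separated if it has no succession. -}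

module Defs where

open import Data.Nat using (ℕ; zero; suc; _+_; _∸_; _<ᵇ_; _≡ᵇ_; _≤ᵇ_)
open import Data.Bool using (Bool; true; false; _∧_; _∨_; not; if_then_else_)
open import Data.List using (List; []; _∷_; map; concatMap; length; filter; upTo)
import Data.Bool.ListAction
open import Data.Product using (_×_; _,_; proj₁; proj₂)
open import Data.Maybe using (Maybe; just; nothing)
open import Relation.Nullary.Decidable using (Dec; yes; no)
open import Relation.Binary.PropositionalEquality using (_≡_)

-- A type B set partition π = π₁ | ⋯ | π_k of ⟨n⟩ without zero block is
-- encoded as a word  w = (b₁ , s₁) ∷ ⋯ ∷ (b_n , s_n)  where, for
-- j ∈ [n], the block index b_j ∈ {0,…,k-1} means that ±j lies in
-- π_{b_j + 1}, and the sign s_j (true = +, false = −) says which of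
-- j, −j belongs to that block.  The normalisation of the paper
-- (m_i > 0, m₁ < ⋯ < m_k) says precisely:
--   * blocks are numbered in order of their least absolute value
--     (restricted growth: a new index is always the next unused one),
--   * the element of least absolute value of each block is positive.
-- Canonical words are thus in bijection with the partitions.

Word : Set
Word = List (ℕ × Bool)

canonicalFrom : ℕ → Word → Bool
canonicalFrom c [] = true
canonicalFrom c ((b , s) ∷ w) =
  if b <ᵇ c then canonicalFrom c w
  else ((b ≡ᵇ c) ∧ s ∧ canonicalFrom (suc c) w)

canonical : Word → Bool
canonical = canonicalFrom 0

blocksFrom : ℕ → Word → ℕ
blocksFrom c [] = c
blocksFrom c ((b , s) ∷ w) = blocksFrom (if b <ᵇ c then c else suc c) w

numBlocks : Word → ℕ
numBlocks = blocksFrom 0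

-- absolute values (1-based positions) of the elements of block with index b
positionsFrom : ℕ → ℕ → Word → List ℕ
positionsFrom b j [] = []
positionsFrom b j ((b' , s) ∷ w) =
  if b ≡ᵇ b' then j ∷ positionsFrom b (suc j) w else positionsFrom b (suc j) w

absBlock : ℕ → Word → List ℕ
absBlock b = positionsFrom b 1

minL : List ℕ → ℕ
minL [] = 0
minL (x ∷ xs) = x     -- positions are produced in increasing order

maxL : List ℕ → ℕ
maxL [] = 0
maxL (x ∷ []) = x
maxL (x ∷ y ∷ xs) = maxL (y ∷ xs)

-- merging-free: no i ∈ {2,…,k} with max|π_{i-1}| < m_i.
-- (block π_i has index i-1; we range over i-1 ∈ {1,…,k-1})
mergingFree : Word → Bool
mergingFree w =
  Data.Bool.ListAction.and (map (λ i → not ((1 ≤ᵇ i) ∧ (maxL (absBlock (i ∸ 1) w) <ᵇ minL (absBlock i w))))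
           (upTo (numBlocks w)))

-- a ∈ {2,…,n} is a succession iff a-1, a lie in the same block or
-- -(a-1), -a lie in the same block, i.e. the consecutive letters
-- (b_{a-1}, s_{a-1}), (b_a, s_a) have equal block index and equal sign.
boolEq : Bool → Bool → Bool
boolEq true true = true
boolEq false false = true
boolEq _ _ = false

isSuccessionPair : (ℕ × Bool) → (ℕ × Bool) → Bool
isSuccessionPair (b , s) (b' , s') = (b ≡ᵇ b') ∧ boolEq s s'

hasSuccession : Word → Bool
hasSuccession [] = false
hasSuccession (x ∷ []) = false
hasSuccession (x ∷ y ∷ w) = isSuccessionPair x y ∨ hasSuccession (y ∷ w)

separated : Word → Bool
separated w = not (hasSuccession w)

numNonSingleton : Word → ℕ
numNonSingleton w =
  length (filter (λ b → 2 Data.Nat.≤? length (absBlock b w)) (upTo (numBlocks w)))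

-- Enumeration of all candidate words of length n with block indices < n
-- (every partition of ⟨n⟩ has at most n blocks).

letters : ℕ → List (ℕ × Bool)
letters m = concatMap (λ b → (b , true) ∷ (b , false) ∷ []) (upTo m)

wordsOf : ℕ → ℕ → List Word
wordsOf m zero = [] ∷ []
wordsOf m (suc l) = concatMap (λ w → map (λ x → x ∷ w) (letters m)) (wordsOf m l)

partitionsB : ℕ → List Word
partitionsB n = filter (λ w → canonical w Data.Bool.≟ true) (wordsOf n n)

countWhere : (Word → Bool) → List Word → ℕ
countWhere p ws = length (filter (λ w → p w Data.Bool.≟ true) ws)

mergingFreeSeparatedCount : ℕ → ℕ → ℕ
mergingFreeSeparatedCount n k =
  countWhere (λ w → (numBlocks w ≡ᵇ k) ∧ mergingFree w ∧ separated w) (partitionsB n)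

nonSingletonCount : ℕ → ℕ → ℕ
nonSingletonCount n j = countWhere (λ w → numNonSingleton w ≡ᵇ j) (partitionsB n)

{-# OPTIONS --safe #-}

-- Both sides are counted by reading a partition as its word of (block, sign) letters, one
-- letter at a time.  Partitions with j non-singleton blocks obey a recurrence in the numbers
-- s of singleton and t of larger blocks opened so far (nonSingletonWays).  A word is
-- merging-free iff the first letter of every block i ≥ 1 is followed by a letter of block
-- i - 1, so merging-free separated partitions with j + 1 blocks, whose first letter is forced,
-- obey a recurrence in the numbers o of blocks still waiting for such a letter and a + 1 of the
-- others (mergingFreeWays).  The two recurrences are related by the binomial transform
-- nonSingletonWays s t = ∑ₒ C(s,o) · mergingFreeWays t o, whose case s = t = 0 is the theorem.

module Submission where

open import Defs
open import Data.Nat using (ℕ; _≤_; _∸_)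
open import Relation.Binary.PropositionalEquality using (_≡_)
open import Data.Nat using (zero; suc; _+_; _*_; _<_; _<ᵇ_; _≡ᵇ_; _≤ᵇ_; z≤n; s≤s; pred)
open import Data.Nat.Properties
open import Data.Nat.ListAction using (sum)
open import Data.Nat.ListAction.Properties using (sum-++)
open import Data.Nat.Solver using (module +-*-Solver)
open import Data.Bool using (Bool; true; false; _∧_; _∨_; not; if_then_else_)
open import Data.Bool.Properties using (∧-zeroʳ; ∧-identityʳ; if-float)
open import Data.Bool.ListAction using (and)
open import Data.List using (List; []; _∷_; _++_; map; concatMap; length; filter; upTo)
open import Data.List.Properties using (map-++; map-cong; map-∘; map-upTo; upTo-∷ʳ; length-upTo)
open import Data.Product using (_×_; _,_)
open import Data.Sum using (inj₁; inj₂)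
open import Function using (_∘_)
open import Relation.Nullary using (does; yes; no)
open import Relation.Nullary.Decidable using (dec-true; dec-false)
open import Relation.Unary using (Decidable)
open import Relation.Binary.PropositionalEquality
  using (_≢_; ≢-sym; refl; sym; trans; cong; cong₂; subst; module ≡-Reasoning)

open import Algebra.Properties.CommutativeSemigroup +-commutativeSemigroup
  using (interchange; x∙yz≈y∙xz; xy∙z≈xz∙y)

open +-*-Solver

-- Sums and counts over lists

𝟙 : Bool → ℕ
𝟙 true = 1
𝟙 false = 0

∑ : {A : Set} → List A → (A → ℕ) → ℕ
∑ xs f = sum (map f xs)

count : {A : Set} → (A → Bool) → List A → ℕ
count p xs = ∑ xs (𝟙 ∘ p)

module _ {A : Set} where

  ∑-cong : (xs : List A) {f g : A → ℕ} → (∀ x → f x ≡ g x) → ∑ xs f ≡ ∑ xs g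
  ∑-cong xs f≗g = cong sum (map-cong f≗g xs)

  ∑-++ : (xs ys : List A) (f : A → ℕ) → ∑ (xs ++ ys) f ≡ ∑ xs f + ∑ ys f
  ∑-++ xs ys f = trans (cong sum (map-++ f xs ys)) (sum-++ (map f xs) (map f ys))

  ∑-zero : (xs : List A) {f : A → ℕ} → (∀ x → f x ≡ 0) → ∑ xs f ≡ 0
  ∑-zero [] f≗0 = refl
  ∑-zero (x ∷ xs) f≗0 rewrite f≗0 x = ∑-zero xs f≗0

  ∑-+ : (xs : List A) (f g : A → ℕ) → ∑ xs (λ x → f x + g x) ≡ ∑ xs f + ∑ xs g
  ∑-+ [] f g = refl
  ∑-+ (x ∷ xs) f g rewrite ∑-+ xs f g = interchange (f x) (g x) (∑ xs f) (∑ xs g)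

  ∑-if : (xs : List A) (p : A → Bool) (X Y : ℕ) →
    ∑ xs (λ x → if p x then X else Y) ≡ count p xs * X + count (not ∘ p) xs * Y
  ∑-if [] p X Y = refl
  ∑-if (x ∷ xs) p X Y with p x
  ... | true rewrite ∑-if xs p X Y = sym (+-assoc X _ _)
  ... | false rewrite ∑-if xs p X Y = x∙yz≈y∙xz Y (count p xs * X) (count (not ∘ p) xs * Y)

  count-cong : (xs : List A) {p q : A → Bool} → (∀ x → p x ≡ q x) → count p xs ≡ count q xs
  count-cong xs p≗q = ∑-cong xs (cong 𝟙 ∘ p≗q)

  count-false : (xs : List A) {p : A → Bool} → (∀ x → p x ≡ false) → count p xs ≡ 0
  count-false xs p≗false = ∑-zero xs (cong 𝟙 ∘ p≗false)

  count-guard : (xs : List A) (g : Bool) (q : A → Bool) →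
    count (λ x → not g ∧ q x) xs ≡ (if g then 0 else count q xs)
  count-guard xs false q = refl
  count-guard xs true q = count-false xs (λ _ → refl)

  count+count-not : (xs : List A) (p : A → Bool) → count p xs + count (not ∘ p) xs ≡ length xs
  count+count-not [] p = refl
  count+count-not (x ∷ xs) p with p x
  ... | true = cong suc (count+count-not xs p)
  ... | false = trans (+-suc _ _) (cong suc (count+count-not xs p))

  length-filter≡count : {P : A → Set} (P? : Decidable P) (xs : List A) →
    length (filter P? xs) ≡ count (does ∘ P?) xs
  length-filter≡count P? [] = refl
  length-filter≡count P? (x ∷ xs) with does (P? x)
  ... | true = cong suc (length-filter≡count P? xs)
  ... | false = length-filter≡count P? xs

  count-filter : (q p : A → Bool) (xs : List A) →
    count p (filter (λ x → q x Data.Bool.≟ true) xs) ≡ count (λ x → q x ∧ p x) xs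
  count-filter q p [] = refl
  count-filter q p (x ∷ xs) with q x
  ... | true = cong (𝟙 (p x) +_) (count-filter q p xs)
  ... | false = count-filter q p xs

module _ {A B : Set} where

  ∑-map : (xs : List A) (g : A → B) (f : B → ℕ) → ∑ (map g xs) f ≡ ∑ xs (f ∘ g)
  ∑-map xs g f = cong sum (sym (map-∘ xs))

  ∑-concatMap : (xs : List A) (g : A → List B) (f : B → ℕ) →
    ∑ (concatMap g xs) f ≡ ∑ xs (λ x → ∑ (g x) f)
  ∑-concatMap [] g f = refl
  ∑-concatMap (x ∷ xs) g f =
    trans (∑-++ (g x) (concatMap g xs) f) (cong (∑ (g x) f +_) (∑-concatMap xs g f))

  ∑-comm : (xs : List A) (ys : List B) (f : A → B → ℕ) →
    ∑ xs (λ x → ∑ ys (f x)) ≡ ∑ ys (λ y → ∑ xs (λ x → f x y))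
  ∑-comm [] ys f = sym (∑-zero ys (λ _ → refl))
  ∑-comm (x ∷ xs) ys f rewrite ∑-comm xs ys f = sym (∑-+ ys (f x) (λ y → ∑ xs (λ x → f x y)))

∑-upTo-suc : (n : ℕ) (f : ℕ → ℕ) → ∑ (upTo (suc n)) f ≡ ∑ (upTo n) f + f n
∑-upTo-suc n f = begin
  ∑ (upTo (suc n)) f     ≡⟨ cong (λ is → ∑ is f) (sym (upTo-∷ʳ n)) ⟩
  ∑ (upTo n ++ n ∷ []) f ≡⟨ ∑-++ (upTo n) (n ∷ []) f ⟩
  ∑ (upTo n) f + (f n + 0) ≡⟨ cong (∑ (upTo n) f +_) (+-identityʳ (f n)) ⟩
  ∑ (upTo n) f + f n     ∎
  where open ≡-Reasoning

∑-upTo-shift : (n : ℕ) (f : ℕ → ℕ) → ∑ (upTo (suc n)) f ≡ f 0 + ∑ (upTo n) (f ∘ suc)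
∑-upTo-shift n f = cong (f 0 +_) (trans (cong (λ is → ∑ is f) (sym (map-upTo suc n))) (∑-map (upTo n) suc f))

∑-upTo-cong : (n : ℕ) {f g : ℕ → ℕ} → (∀ i → i < n → f i ≡ g i) →
  ∑ (upTo n) f ≡ ∑ (upTo n) g
∑-upTo-cong zero f≗g = refl
∑-upTo-cong (suc n) {f} {g} f≗g = begin
  ∑ (upTo (suc n)) f  ≡⟨ ∑-upTo-suc n f ⟩
  ∑ (upTo n) f + f n  ≡⟨ cong₂ _+_ (∑-upTo-cong n (λ i → f≗g i ∘ m<n⇒m<1+n)) (f≗g n ≤-refl) ⟩
  ∑ (upTo n) g + g n  ≡⟨ sym (∑-upTo-suc n g) ⟩
  ∑ (upTo (suc n)) g  ∎
  where open ≡-Reasoning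

∑-upTo-vanishing : (m d : ℕ) (f : ℕ → ℕ) → d ≤ m → (∀ i → d ≤ i → f i ≡ 0) →
  ∑ (upTo m) f ≡ ∑ (upTo d) f
∑-upTo-vanishing m d f d≤m f≗0 with m≤n⇒m<n∨m≡n d≤m
... | inj₂ refl = refl
∑-upTo-vanishing (suc m) d f _ f≗0 | inj₁ (s≤s d≤m) = begin
  ∑ (upTo (suc m)) f  ≡⟨ ∑-upTo-suc m f ⟩
  ∑ (upTo m) f + f m  ≡⟨ cong₂ _+_ (∑-upTo-vanishing m d f d≤m f≗0) (f≗0 m d≤m) ⟩
  ∑ (upTo d) f + 0    ≡⟨ +-identityʳ _ ⟩
  ∑ (upTo d) f        ∎
  where open ≡-Reasoning

-- Stated additively to avoid truncated subtraction.
∑-upTo-point : (n b : ℕ) (f g : ℕ → ℕ) → b < n → (∀ i → i < n → i ≢ b → f i ≡ g i) →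
  ∑ (upTo n) f + g b ≡ ∑ (upTo n) g + f b
∑-upTo-point (suc n) b f g b<1+n f≗g with m≤n⇒m<n∨m≡n (≤-pred b<1+n)
... | inj₂ refl = begin
  ∑ (upTo (suc b)) f + g b   ≡⟨ cong (_+ g b) (∑-upTo-suc b f) ⟩
  ∑ (upTo b) f + f b + g b   ≡⟨ cong (λ z → z + f b + g b) (∑-upTo-cong b below-b) ⟩
  ∑ (upTo b) g + f b + g b   ≡⟨ xy∙z≈xz∙y (∑ (upTo b) g) (f b) (g b) ⟩
  ∑ (upTo b) g + g b + f b   ≡⟨ cong (_+ f b) (sym (∑-upTo-suc b g)) ⟩
  ∑ (upTo (suc b)) g + f b   ∎
  where
  open ≡-Reasoning
  below-b : ∀ i → i < b → f i ≡ g i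
  below-b i i<b = f≗g i (m<n⇒m<1+n i<b) (<⇒≢ i<b)
... | inj₁ b<n = begin
  ∑ (upTo (suc n)) f + g b   ≡⟨ cong (_+ g b) (∑-upTo-suc n f) ⟩
  ∑ (upTo n) f + f n + g b   ≡⟨ xy∙z≈xz∙y (∑ (upTo n) f) (f n) (g b) ⟩
  ∑ (upTo n) f + g b + f n   ≡⟨ cong₂ _+_ (∑-upTo-point n b f g b<n (λ i → f≗g i ∘ m<n⇒m<1+n))
                                          (f≗g n ≤-refl (≢-sym (<⇒≢ b<n))) ⟩
  ∑ (upTo n) g + f b + g n   ≡⟨ xy∙z≈xz∙y (∑ (upTo n) g) (f b) (g n) ⟩
  ∑ (upTo n) g + g n + f b   ≡⟨ cong (_+ f b) (sym (∑-upTo-suc n g)) ⟩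
  ∑ (upTo (suc n)) g + f b   ∎
  where open ≡-Reasoning

count-upTo-point : (n b : ℕ) (p q : ℕ → Bool) → b < n → (∀ i → i ≢ b → p i ≡ q i) →
  count p (upTo n) + 𝟙 (q b) ≡ count q (upTo n) + 𝟙 (p b)
count-upTo-point n b p q b<n p≗q =
  ∑-upTo-point n b (𝟙 ∘ p) (𝟙 ∘ q) b<n (λ i _ i≢b → cong 𝟙 (p≗q i i≢b))

-- Counting words by their first letter

≡ᵇ-refl : ∀ n → (n ≡ᵇ n) ≡ true
≡ᵇ-refl n = dec-true (n ≟ n) refl

≢⇒≡ᵇ≡false : ∀ {m n} → m ≢ n → (m ≡ᵇ n) ≡ false
≢⇒≡ᵇ≡false {m} {n} = dec-false (m ≟ n)

<⇒<ᵇ≡true : ∀ {m n} → m < n → (m <ᵇ n) ≡ true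
<⇒<ᵇ≡true {m} {n} = dec-true (m <? n)

≥⇒<ᵇ≡false : ∀ {m n} → n ≤ m → (m <ᵇ n) ≡ false
≥⇒<ᵇ≡false {m} {n} n≤m = dec-false (m <? n) (≤⇒≯ n≤m)

canonicalFrom-beyond : ∀ {c b} s w → c < b → canonicalFrom c ((b , s) ∷ w) ≡ false
canonicalFrom-beyond s w c<b
  rewrite ≥⇒<ᵇ≡false (<⇒≤ c<b) | ≢⇒≡ᵇ≡false (≢-sym (<⇒≢ c<b)) = refl

canonicalFrom-new-negative : ∀ c w → canonicalFrom c ((c , false) ∷ w) ≡ false
canonicalFrom-new-negative c w rewrite ≥⇒<ᵇ≡false (≤-refl {c}) | ≡ᵇ-refl c = refl

canonicalFrom-new : ∀ c w → canonicalFrom c ((c , true) ∷ w) ≡ canonicalFrom (suc c) w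
canonicalFrom-new c w rewrite ≥⇒<ᵇ≡false (≤-refl {c}) | ≡ᵇ-refl c = refl

countStartingIn : (Word → Bool) → List Word → ℕ → ℕ
countStartingIn p W b = count (λ w → p ((b , true) ∷ w)) W + count (λ w → p ((b , false) ∷ w)) W

count-wordsOf-suc : (m l : ℕ) (p : Word → Bool) →
  count p (wordsOf m (suc l)) ≡ ∑ (upTo m) (countStartingIn p (wordsOf m l))
count-wordsOf-suc m l p = begin
  count p (concatMap (λ w → map (_∷ w) (letters m)) W)
    ≡⟨ ∑-concatMap W (λ w → map (_∷ w) (letters m)) (𝟙 ∘ p) ⟩
  ∑ W (λ w → ∑ (map (_∷ w) (letters m)) (𝟙 ∘ p))
    ≡⟨ ∑-cong W (λ w → ∑-map (letters m) (_∷ w) (𝟙 ∘ p)) ⟩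
  ∑ W (λ w → ∑ (letters m) (λ x → 𝟙 (p (x ∷ w))))
    ≡⟨ ∑-comm W (letters m) (λ w x → 𝟙 (p (x ∷ w))) ⟩
  ∑ (letters m) (λ x → count (λ w → p (x ∷ w)) W)
    ≡⟨ ∑-concatMap (upTo m) (λ b → (b , true) ∷ (b , false) ∷ []) _ ⟩
  ∑ (upTo m) (λ b → count (λ w → p ((b , true) ∷ w)) W + (count (λ w → p ((b , false) ∷ w)) W + 0))
    ≡⟨ ∑-cong (upTo m) (λ b → cong (count (λ w → p ((b , true) ∷ w)) W +_) (+-identityʳ _)) ⟩
  ∑ (upTo m) (countStartingIn p W) ∎
  where
  open ≡-Reasoning
  W = wordsOf m l

count-canonical-wordsOf-suc : (m l c : ℕ) (R : Word → Bool) → c < m →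
  count (λ w → canonicalFrom c w ∧ R w) (wordsOf m (suc l)) ≡
  ∑ (upTo c) (countStartingIn (λ w → canonicalFrom c w ∧ R w) (wordsOf m l))
  + count (λ w → canonicalFrom (suc c) w ∧ R ((c , true) ∷ w)) (wordsOf m l)
count-canonical-wordsOf-suc m l c R c<m = begin
  count Q (wordsOf m (suc l))  ≡⟨ count-wordsOf-suc m l Q ⟩
  ∑ (upTo m) h                 ≡⟨ ∑-upTo-vanishing m (suc c) h c<m h-beyond ⟩
  ∑ (upTo (suc c)) h           ≡⟨ ∑-upTo-suc c h ⟩
  ∑ (upTo c) h + h c           ≡⟨ cong (∑ (upTo c) h +_) h-new ⟩
  ∑ (upTo c) h + count (λ w → canonicalFrom (suc c) w ∧ R ((c , true) ∷ w)) W ∎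
  where
  open ≡-Reasoning
  Q : Word → Bool
  Q w = canonicalFrom c w ∧ R w
  W = wordsOf m l
  h = countStartingIn Q W
  h-beyond : ∀ b → suc c ≤ b → h b ≡ 0
  h-beyond b c<b = cong₂ _+_ (count-false W (λ w → cong (_∧ _) (canonicalFrom-beyond true w c<b)))
                             (count-false W (λ w → cong (_∧ _) (canonicalFrom-beyond false w c<b)))
  h-new : h c ≡ count (λ w → canonicalFrom (suc c) w ∧ R ((c , true) ∷ w)) W
  h-new = trans (cong₂ _+_ (count-cong W (λ w → cong (_∧ R ((c , true) ∷ w)) (canonicalFrom-new c w)))
                           (count-false W (λ w → cong (_∧ R ((c , false) ∷ w)) (canonicalFrom-new-negative c w))))
                (+-identityʳ _)

countWhere-partitionsB : (p : Word → Bool) (n : ℕ) →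
  countWhere p (partitionsB n) ≡ count (λ w → canonical w ∧ p w) (wordsOf n n)
countWhere-partitionsB p n = begin
  countWhere p (partitionsB n)
    ≡⟨ length-filter≡count (λ w → p w Data.Bool.≟ true) (partitionsB n) ⟩
  count (λ w → does (p w Data.Bool.≟ true)) (partitionsB n)
    ≡⟨ count-cong (partitionsB n) (λ w → does-≟-true (p w)) ⟩
  count p (partitionsB n)
    ≡⟨ count-filter canonical p (wordsOf n n) ⟩
  count (λ w → canonical w ∧ p w) (wordsOf n n) ∎
  where
  open ≡-Reasoning
  does-≟-true : ∀ b → does (b Data.Bool.≟ true) ≡ b
  does-≟-true true = refl
  does-≟-true false = refl

-- Binomial sums and the two recurrences

-- binomialSum s g = ∑_{o ≤ s} C(s,o) g(o), defined through Pascal's rule.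
binomialSum : ℕ → (ℕ → ℕ) → ℕ
binomialSum zero g = g 0
binomialSum (suc s) g = binomialSum s g + binomialSum s (g ∘ suc)

binomialSum-+ : ∀ s (f g : ℕ → ℕ) →
  binomialSum s (λ o → f o + g o) ≡ binomialSum s f + binomialSum s g
binomialSum-+ zero f g = refl
binomialSum-+ (suc s) f g rewrite binomialSum-+ s f g | binomialSum-+ s (f ∘ suc) (g ∘ suc) =
  interchange (binomialSum s f) (binomialSum s g) (binomialSum s (f ∘ suc)) (binomialSum s (g ∘ suc))

binomialSum-* : ∀ s k (f : ℕ → ℕ) → binomialSum s (λ o → k * f o) ≡ k * binomialSum s f
binomialSum-* zero k f = refl
binomialSum-* (suc s) k f rewrite binomialSum-* s k f | binomialSum-* s k (f ∘ suc) =
  sym (*-distribˡ-+ k _ _)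

binomialSum-concentrated : ∀ s (g : ℕ → ℕ) → (∀ o → g (suc o) ≡ 0) → binomialSum s g ≡ g 0
binomialSum-concentrated zero g g≗0 = refl
binomialSum-concentrated (suc s) g g≗0 = trans
  (cong₂ _+_ (binomialSum-concentrated s g g≗0)
             (trans (binomialSum-concentrated s (g ∘ suc) (g≗0 ∘ suc)) (g≗0 0)))
  (+-identityʳ (g 0))

-- The absorption identity o · C(s,o) = s · C(s-1,o-1).
binomialSum-absorb : ∀ s (g : ℕ → ℕ) →
  binomialSum s (λ o → o * g o) ≡ s * binomialSum (pred s) (g ∘ suc)
binomialSum-absorb zero g = refl
binomialSum-absorb (suc s) g = begin
  binomialSum s (λ o → o * g o) + binomialSum s (λ o → G o + o * G o)
    ≡⟨ cong₂ _+_ (binomialSum-absorb s g) (binomialSum-+ s G (λ o → o * G o)) ⟩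
  s * binomialSum (pred s) G + (binomialSum s G + binomialSum s (λ o → o * G o))
    ≡⟨ cong (λ z → s * binomialSum (pred s) G + (binomialSum s G + z)) (binomialSum-absorb s G) ⟩
  s * binomialSum (pred s) G + (binomialSum s G + s * binomialSum (pred s) (G ∘ suc))
    ≡⟨ regroup s ⟩
  suc s * binomialSum s G ∎
  where
  open ≡-Reasoning
  G = g ∘ suc
  regroup : ∀ s → s * binomialSum (pred s) G + (binomialSum s G + s * binomialSum (pred s) (G ∘ suc))
                  ≡ suc s * binomialSum s G
  regroup zero = refl
  regroup (suc s) = solve 3 (λ n x y → n :* x :+ (x :+ y :+ n :* y) := x :+ y :+ n :* (x :+ y))
                      refl (suc s) (binomialSum s G) (binomialSum s (G ∘ suc))

-- Ways to append l letters to a partition with s singleton and t larger blocks so that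
-- exactly j blocks end up non-singleton: open a block, or join one of the s + t blocks with
-- either sign.
nonSingletonWays : ℕ → ℕ → ℕ → ℕ → ℕ
nonSingletonWays j zero s t = 𝟙 (t ≡ᵇ j)
nonSingletonWays j (suc l) s t =
  nonSingletonWays j l (suc s) t
  + (s * (2 * nonSingletonWays j l (pred s) (suc t)) + (2 * t) * nonSingletonWays j l s t)

-- Ways to append l letters to a word with 1 + a + o blocks, o of which are pending (block i
-- is pending if block i - 1 has not reappeared since i was opened), so that the result is
-- separated, merging-free and has j + 1 blocks.  A new block is pending; joining block b
-- settles block b + 1; the previous block settles nothing and accepts only the opposite sign.
mergingFreeWays : ℕ → ℕ → ℕ → ℕ → ℕ
mergingFreeWays j zero a o = 𝟙 ((a ≡ᵇ j) ∧ (o ≡ᵇ 0))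
mergingFreeWays j (suc l) a o =
  mergingFreeWays j l a (suc o)
  + (o * (2 * mergingFreeWays j l (suc a) (pred o)) + suc (2 * a) * mergingFreeWays j l a o)

nonSingletonWays≡binomialSum : ∀ j l s t → nonSingletonWays j l s t ≡ binomialSum s (mergingFreeWays j l t)
nonSingletonWays≡binomialSum j zero s t = sym (trans
  (binomialSum-concentrated s _ (λ o → cong 𝟙 (∧-zeroʳ (t ≡ᵇ j))))
  (cong 𝟙 (∧-identityʳ (t ≡ᵇ j))))
nonSingletonWays≡binomialSum j (suc l) s t = begin
  N (suc s) t + (s * (2 * N (pred s) (suc t)) + 2 * t * N s t)
    ≡⟨ cong₂ (λ x y → x + (s * (2 * y) + 2 * t * N s t)) (IH (suc s) t) (IH (pred s) (suc t)) ⟩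
  (A + B) + (C + 2 * t * N s t)
    ≡⟨ cong (λ z → (A + B) + (C + 2 * t * z)) (IH s t) ⟩
  (A + B) + (C + 2 * t * A)
    ≡⟨ solve 4 (λ a b c x → (a :+ b) :+ (c :+ x :* a) := b :+ (c :+ (a :+ x :* a))) refl A B C (2 * t) ⟩
  B + (C + suc (2 * t) * A)
    ≡⟨ cong₂ (λ x y → B + (x + y)) (sym absorbed) (sym (binomialSum-* s (suc (2 * t)) (M t))) ⟩
  B + (binomialSum s (λ o → o * (2 * M (suc t) (pred o))) + binomialSum s (λ o → suc (2 * t) * M t o))
    ≡⟨ cong (B +_) (sym (binomialSum-+ s _ _)) ⟩
  B + binomialSum s (λ o → o * (2 * M (suc t) (pred o)) + suc (2 * t) * M t o)
    ≡⟨ sym (binomialSum-+ s _ _) ⟩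
  binomialSum s (λ o → M t (suc o) + (o * (2 * M (suc t) (pred o)) + suc (2 * t) * M t o)) ∎
  where
  open ≡-Reasoning
  N = nonSingletonWays j l
  M = mergingFreeWays j l
  IH : ∀ s t → N s t ≡ binomialSum s (M t)
  IH = nonSingletonWays≡binomialSum j l
  A = binomialSum s (M t)
  B = binomialSum s (M t ∘ suc)
  C = s * (2 * binomialSum (pred s) (M (suc t)))
  absorbed : binomialSum s (λ o → o * (2 * M (suc t) (pred o))) ≡ C
  absorbed = trans (binomialSum-absorb s (λ o → 2 * M (suc t) (pred o)))
                   (cong (s *_) (binomialSum-* (pred s) 2 (M (suc t))))

-- Partitions by their number of non-singleton blocks

occurrences : ℕ → Word → ℕ
occurrences b [] = 0
occurrences b ((b′ , _) ∷ w) = 𝟙 (b ≡ᵇ b′) + occurrences b w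

length-positionsFrom : ∀ b j w → length (positionsFrom b j w) ≡ occurrences b w
length-positionsFrom b j [] = refl
length-positionsFrom b j ((b′ , _) ∷ w) with b ≡ᵇ b′
... | true = cong suc (length-positionsFrom b (suc j) w)
... | false = length-positionsFrom b (suc j) w

place : (ℕ → ℕ) → ℕ → ℕ → ℕ
place size b i = size i + 𝟙 (i ≡ᵇ b)

place-other : ∀ size {b i} → i ≢ b → place size b i ≡ size i
place-other size i≢b rewrite ≢⇒≡ᵇ≡false i≢b = +-identityʳ _

place-at : ∀ size b → place size b b ≡ suc (size b)
place-at size b rewrite ≡ᵇ-refl b = +-comm (size b) 1

count-place : ∀ c size b (f : ℕ → Bool) → b < c →
  count (f ∘ place size b) (upTo c) + 𝟙 (f (size b))
  ≡ count (f ∘ size) (upTo c) + 𝟙 (f (suc (size b)))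
count-place c size b f b<c =
  subst (λ x → count (f ∘ place size b) (upTo c) + 𝟙 (f (size b)) ≡ count (f ∘ size) (upTo c) + 𝟙 (f x))
        (place-at size b)
        (count-upTo-point c b (f ∘ place size b) (f ∘ size) b<c (λ i → cong f ∘ place-other size))

-- numNonSingleton (u ++ w) for a prefix u that opened c blocks, block b with size b letters.
nonSingletonFrom : ℕ → (ℕ → ℕ) → Word → ℕ
nonSingletonFrom c size w = count (λ b → 2 ≤ᵇ size b + occurrences b w) (upTo (blocksFrom c w))

numNonSingleton≡nonSingletonFrom : ∀ w → numNonSingleton w ≡ nonSingletonFrom 0 (λ _ → 0) w
numNonSingleton≡nonSingletonFrom w =
  trans (length-filter≡count (λ b → 2 Data.Nat.≤? length (absBlock b w)) (upTo (numBlocks w)))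
        (count-cong (upTo (numBlocks w)) (λ b → cong (2 ≤ᵇ_) (length-positionsFrom b 1 w)))

nonSingletonFrom-∷ : ∀ c size b s w →
  nonSingletonFrom c size ((b , s) ∷ w) ≡ nonSingletonFrom (if b <ᵇ c then c else suc c) (place size b) w
nonSingletonFrom-∷ c size b s w = count-cong (upTo (blocksFrom (if b <ᵇ c then c else suc c) w))
  (λ i → cong (2 ≤ᵇ_) (sym (+-assoc (size i) _ (occurrences i w))))

record Sizes (c : ℕ) (size : ℕ → ℕ) : Set where
  field
    opened : ∀ b → b < c → 1 ≤ size b
    unopened : ∀ b → c ≤ b → size b ≡ 0
open Sizes

Sizes-place-old : ∀ {c size b} → Sizes c size → b < c → Sizes c (place size b)
Sizes-place-old {c} {size} {b} sizes b<c = record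
  { opened = λ i i<c → ≤-trans (opened sizes i i<c) (m≤m+n (size i) _)
  ; unopened = λ i c≤i →
      trans (place-other size (≢-sym (<⇒≢ (<-≤-trans b<c c≤i)))) (unopened sizes i c≤i) }

Sizes-place-new : ∀ {c size} → Sizes c size → Sizes (suc c) (place size c)
Sizes-place-new {c} {size} sizes = record { opened = opened′ ; unopened = unopened′ }
  where
  opened′ : ∀ i → i < suc c → 1 ≤ place size c i
  opened′ i i<1+c with m≤n⇒m<n∨m≡n (≤-pred i<1+c)
  ... | inj₂ refl = subst (1 ≤_) (sym (place-at size i)) (s≤s z≤n)
  ... | inj₁ i<c = ≤-trans (opened sizes i i<c) (m≤m+n (size i) _)
  unopened′ : ∀ i → suc c ≤ i → place size c i ≡ 0
  unopened′ i c<i = trans (place-other size (≢-sym (<⇒≢ c<i))) (unopened sizes i (<⇒≤ c<i))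

nonSingletonFrom-new : ∀ c size w →
  nonSingletonFrom c size ((c , true) ∷ w) ≡ nonSingletonFrom (suc c) (place size c) w
nonSingletonFrom-new c size w
  rewrite nonSingletonFrom-∷ c size c true w | ≥⇒<ᵇ≡false (≤-refl {c}) = refl

singletons large : ℕ → (ℕ → ℕ) → ℕ
singletons c size = count (λ b → size b ≡ᵇ 1) (upTo c)
large c size = count (λ b → 2 ≤ᵇ size b) (upTo c)

module _ {c size} (sizes : Sizes c size) where

  count-place-new : (f : ℕ → Bool) →
    count (f ∘ place size c) (upTo (suc c)) ≡ count (f ∘ size) (upTo c) + 𝟙 (f 1)
  count-place-new f = trans (∑-upTo-suc c _) (cong₂ _+_
    (∑-upTo-cong c (λ i i<c → cong (𝟙 ∘ f) (place-other size (<⇒≢ i<c))))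
    (cong (𝟙 ∘ f) (trans (place-at size c) (cong suc (unopened sizes c ≤-refl)))))

  singletons-place-new : singletons (suc c) (place size c) ≡ suc (singletons c size)
  singletons-place-new = trans (count-place-new (_≡ᵇ 1)) (+-comm _ 1)

  large-place-new : large (suc c) (place size c) ≡ large c size
  large-place-new = trans (count-place-new (2 ≤ᵇ_)) (+-identityʳ _)

  count-not-singleton≡large : count (λ b → not (size b ≡ᵇ 1)) (upTo c) ≡ large c size
  count-not-singleton≡large =
    ∑-upTo-cong c (λ b b<c → cong 𝟙 (not-singleton (size b) (opened sizes b b<c)))
    where
    not-singleton : ∀ x → 1 ≤ x → not (x ≡ᵇ 1) ≡ (2 ≤ᵇ x)
    not-singleton (suc zero) _ = refl
    not-singleton (suc (suc x)) _ = refl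

  -- A letter of an old block b turns a singleton into a non-singleton iff size b ≡ 1.
  singletons-large-place-old : ∀ {b} → b < c → (g : ℕ → ℕ → ℕ) →
    g (singletons c (place size b)) (large c (place size b))
    ≡ (if size b ≡ᵇ 1 then g (pred (singletons c size)) (suc (large c size))
                       else g (singletons c size) (large c size))
  singletons-large-place-old {b} b<c g
    with size b | opened sizes b b<c | count-place c size b (_≡ᵇ 1) b<c | count-place c size b (2 ≤ᵇ_) b<c
  ... | suc zero | _ | s′+1≡s+0 | t′+0≡t+1 =
    cong₂ g (cong pred (trans (+-comm 1 _) (trans s′+1≡s+0 (+-identityʳ _))))
            (trans (sym (+-identityʳ _)) (trans t′+0≡t+1 (+-comm _ 1)))
  ... | suc (suc _) | _ | s′≡s | t′≡t = cong₂ g (+-cancelʳ-≡ _ _ _ s′≡s) (+-cancelʳ-≡ _ _ _ t′≡t)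

module NonSingletons (j : ℕ) where

  constraint : ℕ → (ℕ → ℕ) → Word → Bool
  constraint c size w = nonSingletonFrom c size w ≡ᵇ j

  accepts : ℕ → (ℕ → ℕ) → Word → Bool
  accepts c size w = canonicalFrom c w ∧ constraint c size w

  accepts-old : ∀ c size {b} s w → b < c → accepts c size ((b , s) ∷ w) ≡ accepts c (place size b) w
  accepts-old c size {b} s w b<c rewrite nonSingletonFrom-∷ c size b s w | <⇒<ᵇ≡true b<c = refl

  Counted : ℕ → ℕ → Set
  Counted m l = ∀ {c size} → Sizes c size → c + l ≤ m →
    count (accepts c size) (wordsOf m l) ≡ nonSingletonWays j l (singletons c size) (large c size)

  count-accepts-zero : ∀ m → Counted m 0
  count-accepts-zero m {c} {size} _ _ = trans (+-identityʳ _)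
    (cong (λ n → 𝟙 (n ≡ᵇ j)) (count-cong (upTo c) (λ b → cong (2 ≤ᵇ_) (+-identityʳ (size b)))))

  module Step {m l} (IH : Counted m l) {c size} (sizes : Sizes c size) (c+l<m : c + suc l ≤ m) where

    N = nonSingletonWays j l
    s = singletons c size
    t = large c size
    X = N (pred s) (suc t)
    Y = N s t
    W = wordsOf m l

    countStartingIn-old : ∀ b → b < c →
      countStartingIn (accepts c size) W b ≡ (if size b ≡ᵇ 1 then X + X else Y + Y)
    countStartingIn-old b b<c = begin
      countStartingIn (accepts c size) W b
        ≡⟨ cong₂ _+_ (count-cong W (λ w → accepts-old c size true w b<c))
                     (count-cong W (λ w → accepts-old c size false w b<c)) ⟩
      count (accepts c (place size b)) W + count (accepts c (place size b)) W
        ≡⟨ cong (λ n → n + n) (IH (Sizes-place-old sizes b<c) (≤-trans (+-monoʳ-≤ c (n≤1+n l)) c+l<m)) ⟩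
      N s′ t′ + N s′ t′
        ≡⟨ singletons-large-place-old sizes b<c (λ s t → N s t + N s t) ⟩
      (if size b ≡ᵇ 1 then X + X else Y + Y) ∎
      where
      open ≡-Reasoning
      s′ = singletons c (place size b)
      t′ = large c (place size b)

    count-new : count (λ w → canonicalFrom (suc c) w ∧ constraint c size ((c , true) ∷ w)) W ≡ N (suc s) t
    count-new = begin
      count (λ w → canonicalFrom (suc c) w ∧ constraint c size ((c , true) ∷ w)) W
        ≡⟨ count-cong W (λ w → cong (λ n → canonicalFrom (suc c) w ∧ (n ≡ᵇ j))
                                    (nonSingletonFrom-new c size w)) ⟩
      count (accepts (suc c) (place size c)) W
        ≡⟨ IH (Sizes-place-new sizes) (subst (_≤ m) (+-suc c l) c+l<m) ⟩
      N (singletons (suc c) (place size c)) (large (suc c) (place size c))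
        ≡⟨ cong₂ N (singletons-place-new sizes) (large-place-new sizes) ⟩
      N (suc s) t ∎
      where open ≡-Reasoning

    counted : count (accepts c size) (wordsOf m (suc l)) ≡ nonSingletonWays j (suc l) s t
    counted = begin
      count (accepts c size) (wordsOf m (suc l))
        ≡⟨ count-canonical-wordsOf-suc m l c (constraint c size) (<-≤-trans (m<m+n c (s≤s z≤n)) c+l<m) ⟩
      ∑ (upTo c) (countStartingIn (accepts c size) W) + _
        ≡⟨ cong₂ _+_ (∑-upTo-cong c countStartingIn-old) count-new ⟩
      ∑ (upTo c) (λ b → if size b ≡ᵇ 1 then X + X else Y + Y) + N (suc s) t
        ≡⟨ cong (_+ N (suc s) t) (∑-if (upTo c) (λ b → size b ≡ᵇ 1) (X + X) (Y + Y)) ⟩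
      s * (X + X) + count (λ b → not (size b ≡ᵇ 1)) (upTo c) * (Y + Y) + N (suc s) t
        ≡⟨ cong (λ n → s * (X + X) + n * (Y + Y) + N (suc s) t) (count-not-singleton≡large sizes) ⟩
      s * (X + X) + t * (Y + Y) + N (suc s) t
        ≡⟨ solve 5 (λ s x t y r → s :* (x :+ x) :+ t :* (y :+ y) :+ r
                                  := r :+ (s :* (con 2 :* x) :+ (con 2 :* t) :* y))
                 refl s X t Y (N (suc s) t) ⟩
      nonSingletonWays j (suc l) s t ∎
      where open ≡-Reasoning

  count-accepts : ∀ m l → Counted m l
  count-accepts m zero = count-accepts-zero m
  count-accepts m (suc l) sizes c+l<m = Step.counted (count-accepts m l) sizes c+l<m

  nonSingletonCount≡nonSingletonWays : ∀ m → nonSingletonCount m j ≡ nonSingletonWays j m 0 0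
  nonSingletonCount≡nonSingletonWays m = begin
    nonSingletonCount m j
      ≡⟨ countWhere-partitionsB (λ w → numNonSingleton w ≡ᵇ j) m ⟩
    count (λ w → canonical w ∧ (numNonSingleton w ≡ᵇ j)) (wordsOf m m)
      ≡⟨ count-cong (wordsOf m m)
                    (λ w → cong (λ n → canonical w ∧ (n ≡ᵇ j)) (numNonSingleton≡nonSingletonFrom w)) ⟩
    count (accepts 0 (λ _ → 0)) (wordsOf m m)
      ≡⟨ count-accepts m m (record { opened = λ _ () ; unopened = λ _ _ → refl }) ≤-refl ⟩
    nonSingletonWays j m 0 0 ∎
    where open ≡-Reasoning

-- Merging-free separated partitions

setIfUnset : ℕ → ℕ → ℕ
setIfUnset f q = if f ≡ᵇ 0 then q else f

-- first i is the position of the first letter of block i read so far (0 if none), last i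
-- that of the last one.

noteFirst noteLast : (ℕ → ℕ) → ℕ → ℕ → ℕ → ℕ
noteFirst first b q i = if i ≡ᵇ b then setIfUnset (first i) q else first i
noteLast last b q i = if i ≡ᵇ b then q else last i

firstPosition : ℕ → List ℕ → ℕ
firstPosition f ps = if f ≡ᵇ 0 then minL ps else f

lastOr : ℕ → List ℕ → ℕ
lastOr d [] = d
lastOr d (x ∷ xs) = lastOr x xs

maxL≡lastOr : ∀ xs → maxL xs ≡ lastOr 0 xs
maxL≡lastOr [] = refl
maxL≡lastOr (x ∷ []) = refl
maxL≡lastOr (x ∷ y ∷ xs) = maxL≡lastOr (y ∷ xs)

pending : (ℕ → ℕ) → (ℕ → ℕ) → ℕ → Bool
pending first last i = (1 ≤ᵇ i) ∧ (last (i ∸ 1) <ᵇ first i)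

numPending : ℕ → (ℕ → ℕ) → (ℕ → ℕ) → ℕ
numPending c first last = count (pending first last) (upTo c)

-- mergingFree (u ++ w) for a prefix u of length q - 1 that opened c blocks with the given first
-- and last positions.
mergingFreeFrom : ℕ → (ℕ → ℕ) → (ℕ → ℕ) → ℕ → Word → Bool
mergingFreeFrom c first last q w = and (map (not ∘ pending first′ last′) (upTo (blocksFrom c w)))
  where
  first′ last′ : ℕ → ℕ
  first′ i = firstPosition (first i) (positionsFrom i q w)
  last′ i = lastOr (last i) (positionsFrom i q w)

and-map-cong : (xs : List ℕ) {f g : ℕ → Bool} → (∀ i → f i ≡ g i) → and (map f xs) ≡ and (map g xs)
and-map-cong xs f≗g = cong and (map-cong f≗g xs)

mergingFree≡mergingFreeFrom : ∀ w → mergingFree w ≡ mergingFreeFrom 0 (λ _ → 0) (λ _ → 0) 1 w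
mergingFree≡mergingFreeFrom w = and-map-cong (upTo (numBlocks w))
  (λ i → cong (λ x → not ((1 ≤ᵇ i) ∧ (x <ᵇ minL (absBlock i w)))) (maxL≡lastOr (absBlock (i ∸ 1) w)))

lastOr-positionsFrom-∷ : ∀ d i q b s w →
  lastOr d (positionsFrom i q ((b , s) ∷ w)) ≡ lastOr (if i ≡ᵇ b then q else d) (positionsFrom i (suc q) w)
lastOr-positionsFrom-∷ d i q b s w with i ≡ᵇ b
... | true = refl
... | false = refl

firstPosition-positionsFrom-∷ : ∀ f i q b s w →
  firstPosition f (positionsFrom i (suc q) ((b , s) ∷ w))
  ≡ firstPosition (if i ≡ᵇ b then setIfUnset f (suc q) else f) (positionsFrom i (suc (suc q)) w)
firstPosition-positionsFrom-∷ f i q b s w with i ≡ᵇ b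
... | false = refl
... | true with f
...   | zero = refl
...   | suc _ = refl

mergingFreeFrom-∷ : ∀ c first last q b s w →
  mergingFreeFrom c first last (suc q) ((b , s) ∷ w)
  ≡ mergingFreeFrom (if b <ᵇ c then c else suc c) (noteFirst first b (suc q)) (noteLast last b (suc q)) (suc (suc q)) w
mergingFreeFrom-∷ c first last q b s w = and-map-cong (upTo (blocksFrom (if b <ᵇ c then c else suc c) w))
  (λ i → cong₂ (λ x y → not ((1 ≤ᵇ i) ∧ (x <ᵇ y)))
           (lastOr-positionsFrom-∷ (last (i ∸ 1)) (i ∸ 1) (suc q) b s w)
           (firstPosition-positionsFrom-∷ (first i) i q b s w))

and-map-not≡count≡ᵇ0 : (xs : List ℕ) (p : ℕ → Bool) → and (map (not ∘ p) xs) ≡ (count p xs ≡ᵇ 0)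
and-map-not≡count≡ᵇ0 [] p = refl
and-map-not≡count≡ᵇ0 (x ∷ xs) p with p x
... | true = refl
... | false = and-map-not≡count≡ᵇ0 xs p

mergingFreeFrom-[] : ∀ c first last q → mergingFreeFrom c first last q [] ≡ (numPending c first last ≡ᵇ 0)
mergingFreeFrom-[] c first last q = trans
  (and-map-cong (upTo c)
    (λ i → cong (λ f → not ((1 ≤ᵇ i) ∧ (last (i ∸ 1) <ᵇ f))) (firstPosition-[] (first i))))
  (and-map-not≡count≡ᵇ0 (upTo c) (pending first last))
  where
  firstPosition-[] : ∀ f → firstPosition f [] ≡ f
  firstPosition-[] zero = refl
  firstPosition-[] (suc f) = refl

hasSuccessionAfter : ℕ × Bool → Word → Bool
hasSuccessionAfter x [] = false
hasSuccessionAfter x (y ∷ w) = isSuccessionPair x y ∨ hasSuccessionAfter y w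

hasSuccession≡hasSuccessionAfter : ∀ x w → hasSuccession (x ∷ w) ≡ hasSuccessionAfter x w
hasSuccession≡hasSuccessionAfter x [] = refl
hasSuccession≡hasSuccessionAfter x (y ∷ w) = cong (isSuccessionPair x y ∨_) (hasSuccession≡hasSuccessionAfter y w)

-- The state after reading p letters, the last one in block pb, with c blocks opened.
record Positions (c : ℕ) (first last : ℕ → ℕ) (p pb : ℕ) : Set where
  field
    first-opened : ∀ i → i < c → 1 ≤ first i
    first-unopened : ∀ i → c ≤ i → first i ≡ 0
    first≤ : ∀ i → first i ≤ p
    last≤ : ∀ i → last i ≤ p
    prev-opened : pb < c
    last-prev : last pb ≡ p
open Positions

noteLast-at : ∀ last b q → noteLast last b q b ≡ q
noteLast-at last b q rewrite ≡ᵇ-refl b = refl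

noteLast-other : ∀ last {b i} q → i ≢ b → noteLast last b q i ≡ last i
noteLast-other last q i≢b rewrite ≢⇒≡ᵇ≡false i≢b = refl

noteFirst-other : ∀ first {b i} q → i ≢ b → noteFirst first b q i ≡ first i
noteFirst-other first q i≢b rewrite ≢⇒≡ᵇ≡false i≢b = refl

noteFirst-unset : ∀ first b q → first b ≡ 0 → noteFirst first b q b ≡ q
noteFirst-unset first b q first-b≡0 rewrite ≡ᵇ-refl b | first-b≡0 = refl

noteFirst-set : ∀ first {b} q → 1 ≤ first b → ∀ i → noteFirst first b q i ≡ first i
noteFirst-set first {b} q 1≤first-b i with i ≟ b
... | no i≢b = noteFirst-other first q i≢b
... | yes refl rewrite ≡ᵇ-refl i with first i | 1≤first-b
...   | suc _ | _ = refl

noteFirst-≤ : ∀ first b {p} → (∀ i → first i ≤ p) → ∀ i → noteFirst first b (suc p) i ≤ suc p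
noteFirst-≤ first b first≤p i with i ≡ᵇ b | first i ≡ᵇ 0
... | true | true = ≤-refl
... | true | false = m≤n⇒m≤1+n (first≤p i)
... | false | _ = m≤n⇒m≤1+n (first≤p i)

noteLast-≤ : ∀ last b {p} → (∀ i → last i ≤ p) → ∀ i → noteLast last b (suc p) i ≤ suc p
noteLast-≤ last b last≤p i with i ≡ᵇ b
... | true = ≤-refl
... | false = m≤n⇒m≤1+n (last≤p i)

pending-unopened : ∀ first last {i} → first i ≡ 0 → pending first last i ≡ false
pending-unopened first last {zero} _ = refl
pending-unopened first last {suc i} first-i≡0 rewrite first-i≡0 = refl

pending-opened : ∀ {c} first last {p} → 0 < c → (∀ i → i < c → last i ≤ p) → first c ≡ suc p →
  pending first last c ≡ true
pending-opened {suc c} first last _ last≤p first-c≡1+p =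
  trans (cong (last c <ᵇ_) first-c≡1+p) (<⇒<ᵇ≡true (s≤s (last≤p c ≤-refl)))

numPending-upTo-suc : ∀ c first last → first c ≡ 0 →
  numPending c first last ≡ count (pending first last) (upTo (suc c))
numPending-upTo-suc c first last first-c≡0 = sym (trans (∑-upTo-suc c _)
  (trans (cong (λ x → numPending c first last + 𝟙 x) (pending-unopened first last first-c≡0)) (+-identityʳ _)))

module _ {c first last p pb} (pos : Positions c first last p pb) where

  Positions-old : ∀ {b} → b < c → Positions c (noteFirst first b (suc p)) (noteLast last b (suc p)) (suc p) b
  Positions-old {b} b<c = record
    { first-opened = λ i i<c → subst (1 ≤_) (sym (unchanged i)) (first-opened pos i i<c)
    ; first-unopened = λ i c≤i → trans (unchanged i) (first-unopened pos i c≤i)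
    ; first≤ = noteFirst-≤ first b (first≤ pos)
    ; last≤ = noteLast-≤ last b (last≤ pos)
    ; prev-opened = b<c
    ; last-prev = noteLast-at last b (suc p) }
    where
    unchanged : ∀ i → noteFirst first b (suc p) i ≡ first i
    unchanged = noteFirst-set first (suc p) (first-opened pos b b<c)

  Positions-new : Positions (suc c) (noteFirst first c (suc p)) (noteLast last c (suc p)) (suc p) c
  Positions-new = record
    { first-opened = first-opened′
    ; first-unopened = λ i c<i →
        trans (noteFirst-other first (suc p) (≢-sym (<⇒≢ c<i))) (first-unopened pos i (<⇒≤ c<i))
    ; first≤ = noteFirst-≤ first c (first≤ pos)
    ; last≤ = noteLast-≤ last c (last≤ pos)
    ; prev-opened = ≤-refl
    ; last-prev = noteLast-at last c (suc p) }
    where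
    first-opened′ : ∀ i → i < suc c → 1 ≤ noteFirst first c (suc p) i
    first-opened′ i i<1+c with m≤n⇒m<n∨m≡n (≤-pred i<1+c)
    ... | inj₂ refl =
      subst (1 ≤_) (sym (noteFirst-unset first i (suc p) (first-unopened pos i ≤-refl))) (s≤s z≤n)
    ... | inj₁ i<c = subst (1 ≤_) (sym (noteFirst-other first (suc p) (<⇒≢ i<c))) (first-opened pos i i<c)

  numPending≡count-settled : numPending c first last ≡ count (λ b → pending first last (suc b)) (upTo c)
  numPending≡count-settled =
    trans (numPending-upTo-suc c first last (first-unopened pos c ≤-refl))
          (∑-upTo-shift c (𝟙 ∘ pending first last))

  pending-after-prev : pending first last (suc pb) ≡ false
  pending-after-prev = trans (cong (_<ᵇ first (suc pb)) (last-prev pos)) (≥⇒<ᵇ≡false (first≤ pos (suc pb)))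

  numPending-old : ∀ {b} → b < c →
    numPending c (noteFirst first b (suc p)) (noteLast last b (suc p)) + 𝟙 (pending first last (suc b))
    ≡ numPending c first last
  numPending-old {b} b<c = begin
    numPending c first′ last′ + 𝟙 (pending first last (suc b))
      ≡⟨ cong (_+ 𝟙 (pending first last (suc b)))
              (numPending-upTo-suc c first′ last′ (trans (unchanged c) first-c≡0)) ⟩
    count (pending first′ last′) (upTo (suc c)) + 𝟙 (pending first last (suc b))
      ≡⟨ count-upTo-point (suc c) (suc b) (pending first′ last′) (pending first last) (s≤s b<c) same ⟩
    count (pending first last) (upTo (suc c)) + 𝟙 (pending first′ last′ (suc b))
      ≡⟨ cong (λ x → count (pending first last) (upTo (suc c)) + 𝟙 x) settled ⟩
    count (pending first last) (upTo (suc c)) + 0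
      ≡⟨ trans (+-identityʳ _) (sym (numPending-upTo-suc c first last first-c≡0)) ⟩
    numPending c first last ∎
    where
    open ≡-Reasoning
    first′ = noteFirst first b (suc p)
    last′ = noteLast last b (suc p)
    first-c≡0 = first-unopened pos c ≤-refl
    unchanged : ∀ i → first′ i ≡ first i
    unchanged = noteFirst-set first (suc p) (first-opened pos b b<c)
    same : ∀ i → i ≢ suc b → pending first′ last′ i ≡ pending first last i
    same zero _ = refl
    same (suc i) i+1≢b+1 = cong₂ _<ᵇ_ (noteLast-other last (suc p) (i+1≢b+1 ∘ cong suc)) (unchanged (suc i))
    settled : pending first′ last′ (suc b) ≡ false
    settled = trans (cong₂ _<ᵇ_ (noteLast-at last b (suc p)) (unchanged (suc b)))
                    (≥⇒<ᵇ≡false (m≤n⇒m≤1+n (first≤ pos (suc b))))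

  numPending-new :
    numPending (suc c) (noteFirst first c (suc p)) (noteLast last c (suc p)) ≡ suc (numPending c first last)
  numPending-new = trans (∑-upTo-suc c _)
    (trans (cong₂ _+_ (∑-upTo-cong c (λ i i<c → cong 𝟙 (same i i<c))) (cong 𝟙 new-pending)) (+-comm _ 1))
    where
    first′ = noteFirst first c (suc p)
    last′ = noteLast last c (suc p)
    same : ∀ i → i < c → pending first′ last′ i ≡ pending first last i
    same zero _ = refl
    same (suc i) i+1<c = cong₂ _<ᵇ_ (noteLast-other last (suc p) (<⇒≢ (<-trans (n<1+n i) i+1<c)))
                                     (noteFirst-other first (suc p) (<⇒≢ i+1<c))
    new-pending : pending first′ last′ c ≡ true
    new-pending = pending-opened first′ last′ (≤-trans (s≤s z≤n) (prev-opened pos))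
      (λ i i<c → subst (_≤ p) (sym (noteLast-other last (suc p) (<⇒≢ i<c))) (last≤ pos i))
      (noteFirst-unset first c (suc p) (first-unopened pos c ≤-refl))

∧-∧-∧-not-∨ : ∀ x y z u v → x ∧ (y ∧ (z ∧ not (u ∨ v))) ≡ not u ∧ (x ∧ (y ∧ (z ∧ not v)))
∧-∧-∧-not-∨ x y z false v = refl
∧-∧-∧-not-∨ false y z true v = refl
∧-∧-∧-not-∨ true false z true v = refl
∧-∧-∧-not-∨ true true false true v = refl
∧-∧-∧-not-∨ true true true true v = refl

-- Two signs are allowed in every old block except that of the previous letter.
∑-upTo-doubled-but-one : ∀ c b₀ (h : ℕ → ℕ) (P : ℕ → Bool) X Y → b₀ < c →
  (∀ b → b < c → b ≢ b₀ → h b ≡ (if P b then X + X else Y + Y)) → P b₀ ≡ false → h b₀ ≡ Y →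
  ∑ (upTo c) h + Y ≡ count P (upTo c) * (X + X) + count (not ∘ P) (upTo c) * (Y + Y)
∑-upTo-doubled-but-one c b₀ h P X Y b₀<c h-doubled P-b₀ h-b₀ = +-cancelʳ-≡ Y _ _ (begin
  ∑ (upTo c) h + Y + Y      ≡⟨ +-assoc (∑ (upTo c) h) Y Y ⟩
  ∑ (upTo c) h + (Y + Y)    ≡⟨ cong (λ v → ∑ (upTo c) h + (if v then X + X else Y + Y)) (sym P-b₀) ⟩
  ∑ (upTo c) h + g b₀       ≡⟨ ∑-upTo-point c b₀ h g b₀<c h-doubled ⟩
  ∑ (upTo c) g + h b₀       ≡⟨ cong₂ _+_ (∑-if (upTo c) P (X + X) (Y + Y)) h-b₀ ⟩
  count P (upTo c) * (X + X) + count (not ∘ P) (upTo c) * (Y + Y) + Y ∎)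
  where
  open ≡-Reasoning
  g : ℕ → ℕ
  g b = if P b then X + X else Y + Y

module MergingFreeSeparated (j : ℕ) where

  constraint : ℕ → (ℕ → ℕ) → (ℕ → ℕ) → ℕ → ℕ × Bool → Word → Bool
  constraint c first last p prev w =
    (blocksFrom c w ≡ᵇ suc j) ∧ (mergingFreeFrom c first last (suc p) w ∧ not (hasSuccessionAfter prev w))

  accepts : ℕ → (ℕ → ℕ) → (ℕ → ℕ) → ℕ → ℕ × Bool → Word → Bool
  accepts c first last p prev w = canonicalFrom c w ∧ constraint c first last p prev w

  accepts-old : ∀ c first last p prev {b} s w → b < c →
    accepts c first last p prev ((b , s) ∷ w)
    ≡ not (isSuccessionPair prev (b , s))
      ∧ accepts c (noteFirst first b (suc p)) (noteLast last b (suc p)) (suc p) (b , s) w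
  accepts-old c first last p prev {b} s w b<c
    rewrite mergingFreeFrom-∷ c first last p b s w | <⇒<ᵇ≡true b<c =
    ∧-∧-∧-not-∨ (canonicalFrom c w) (blocksFrom c w ≡ᵇ suc j)
      (mergingFreeFrom c (noteFirst first b (suc p)) (noteLast last b (suc p)) (suc (suc p)) w)
      (isSuccessionPair prev (b , s)) (hasSuccessionAfter (b , s) w)

  accepts-new : ∀ c first last p {pb} ps w → pb < c →
    canonicalFrom (suc c) w ∧ constraint c first last p (pb , ps) ((c , true) ∷ w)
    ≡ accepts (suc c) (noteFirst first c (suc p)) (noteLast last c (suc p)) (suc p) (c , true) w
  accepts-new c first last p {pb} ps w pb<c
    rewrite mergingFreeFrom-∷ c first last p c true w | ≥⇒<ᵇ≡false (≤-refl {c}) | ≢⇒≡ᵇ≡false (<⇒≢ pb<c)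
    = refl

  blocks-and-none-pending : ∀ c a o → c ≡ suc (a + o) →
    ((c ≡ᵇ suc j) ∧ ((o ≡ᵇ 0) ∧ true)) ≡ ((a ≡ᵇ j) ∧ (o ≡ᵇ 0))
  blocks-and-none-pending _ a zero refl rewrite +-identityʳ a = refl
  blocks-and-none-pending _ a (suc o) refl = trans (∧-zeroʳ _) (sym (∧-zeroʳ _))

  Counted : ℕ → ℕ → Set
  Counted m l = ∀ {c first last p pb} ps a → Positions c first last p pb → c + l ≤ m →
    c ≡ suc (a + numPending c first last) →
    count (accepts c first last p (pb , ps)) (wordsOf m l) ≡ mergingFreeWays j l a (numPending c first last)

  count-accepts-zero : ∀ m → Counted m 0
  count-accepts-zero m {c} {first} {last} {p} ps a _ _ c≡1+a+o = trans (+-identityʳ _)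
    (cong 𝟙 (trans (cong (λ x → (c ≡ᵇ suc j) ∧ (x ∧ true)) (mergingFreeFrom-[] c first last (suc p)))
                   (blocks-and-none-pending c a (numPending c first last) c≡1+a+o)))

  module Step {m l} (IH : Counted m l) {c first last p pb} (ps : Bool) (a : ℕ)
              (pos : Positions c first last p pb) (c+l<m : c + suc l ≤ m)
              (c≡1+a+o : c ≡ suc (a + numPending c first last)) where

    M = mergingFreeWays j l
    o = numPending c first last
    X = M (suc a) (pred o)
    Y = M a o
    W = wordsOf m l
    Q = accepts c first last p (pb , ps)

    Q′ : ℕ → Bool → Word → Bool
    Q′ b s = accepts c (noteFirst first b (suc p)) (noteLast last b (suc p)) (suc p) (b , s)

    settles : ℕ → Bool
    settles b = pending first last (suc b)

    value : ℕ → ℕ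
    value b = if settles b then X else Y

    count-after-old : ∀ {b} s → b < c → count (Q′ b s) W ≡ value b
    count-after-old {b} s b<c with settles b | numPending-old pos b<c
    ... | true | o′+1≡o =
      trans (IH s (suc a) (Positions-old pos b<c) c+l≤m c≡2+a+o′) (cong (M (suc a)) o′≡o-1)
      where
      o′ = numPending c (noteFirst first b (suc p)) (noteLast last b (suc p))
      o′≡o-1 : o′ ≡ pred o
      o′≡o-1 = cong pred (trans (+-comm 1 o′) o′+1≡o)
      c≡2+a+o′ : c ≡ suc (suc a + o′)
      c≡2+a+o′ = trans c≡1+a+o
        (cong suc (trans (cong (a +_) (sym o′+1≡o)) (trans (sym (+-assoc a o′ 1)) (+-comm _ 1))))
      c+l≤m = ≤-trans (+-monoʳ-≤ c (n≤1+n l)) c+l<m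
    ... | false | o′+0≡o =
      trans (IH s a (Positions-old pos b<c) c+l≤m c≡1+a+o′) (cong (M a) o′≡o)
      where
      o′ = numPending c (noteFirst first b (suc p)) (noteLast last b (suc p))
      o′≡o : o′ ≡ o
      o′≡o = trans (sym (+-identityʳ o′)) o′+0≡o
      c≡1+a+o′ : c ≡ suc (a + o′)
      c≡1+a+o′ = trans c≡1+a+o (cong (λ x → suc (a + x)) (sym o′≡o))
      c+l≤m = ≤-trans (+-monoʳ-≤ c (n≤1+n l)) c+l<m

    count-starting-old : ∀ {b} s → b < c →
      count (λ w → Q ((b , s) ∷ w)) W ≡ (if isSuccessionPair (pb , ps) (b , s) then 0 else value b)
    count-starting-old {b} s b<c = begin
      count (λ w → Q ((b , s) ∷ w)) W
        ≡⟨ count-cong W (λ w → accepts-old c first last p (pb , ps) s w b<c) ⟩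
      count (λ w → not (isSuccessionPair (pb , ps) (b , s)) ∧ Q′ b s w) W
        ≡⟨ count-guard W (isSuccessionPair (pb , ps) (b , s)) (Q′ b s) ⟩
      (if isSuccessionPair (pb , ps) (b , s) then 0 else count (Q′ b s) W)
        ≡⟨ cong (if isSuccessionPair (pb , ps) (b , s) then 0 else_) (count-after-old s b<c) ⟩
      (if isSuccessionPair (pb , ps) (b , s) then 0 else value b) ∎
      where open ≡-Reasoning

    countStartingIn-other : ∀ b → b < c → b ≢ pb → countStartingIn Q W b ≡ (if settles b then X + X else Y + Y)
    countStartingIn-other b b<c b≢pb = begin
      countStartingIn Q W b
        ≡⟨ cong₂ _+_ (count-starting-old true b<c) (count-starting-old false b<c) ⟩
      (if isSuccessionPair (pb , ps) (b , true) then 0 else value b)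
      + (if isSuccessionPair (pb , ps) (b , false) then 0 else value b)
        ≡⟨ cong₂ (λ u v → (if u then 0 else value b) + (if v then 0 else value b))
                 (distinct true) (distinct false) ⟩
      value b + value b
        ≡⟨ if-float (λ v → v + v) (settles b) ⟩
      (if settles b then X + X else Y + Y) ∎
      where
      open ≡-Reasoning
      distinct : ∀ s → isSuccessionPair (pb , ps) (b , s) ≡ false
      distinct s = cong (_∧ boolEq ps s) (≢⇒≡ᵇ≡false (≢-sym b≢pb))

    countStartingIn-prev : countStartingIn Q W pb ≡ Y
    countStartingIn-prev = begin
      countStartingIn Q W pb
        ≡⟨ cong₂ _+_ (count-starting-old true (prev-opened pos)) (count-starting-old false (prev-opened pos)) ⟩
      (if isSuccessionPair (pb , ps) (pb , true) then 0 else value pb)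
      + (if isSuccessionPair (pb , ps) (pb , false) then 0 else value pb)
        ≡⟨ one-sign ps ⟩
      value pb
        ≡⟨ cong (if_then X else Y) (pending-after-prev pos) ⟩
      Y ∎
      where
      open ≡-Reasoning
      one-sign : ∀ s → (if isSuccessionPair (pb , s) (pb , true) then 0 else value pb)
                       + (if isSuccessionPair (pb , s) (pb , false) then 0 else value pb) ≡ value pb
      one-sign s rewrite ≡ᵇ-refl pb with s
      ... | true = refl
      ... | false = +-identityʳ (value pb)

    count-not-settles : count (not ∘ settles) (upTo c) ≡ suc a
    count-not-settles = +-cancelˡ-≡ o _ _ (begin
      o + count (not ∘ settles) (upTo c)
        ≡⟨ cong (_+ count (not ∘ settles) (upTo c)) (numPending≡count-settled pos) ⟩
      count settles (upTo c) + count (not ∘ settles) (upTo c)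
        ≡⟨ trans (count+count-not (upTo c) settles) (length-upTo c) ⟩
      c
        ≡⟨ trans c≡1+a+o (cong suc (+-comm a o)) ⟩
      suc (o + a)
        ≡⟨ sym (+-suc o a) ⟩
      o + suc a ∎)
      where open ≡-Reasoning

    ∑-countStartingIn-old : ∑ (upTo c) (countStartingIn Q W) ≡ o * (X + X) + suc (2 * a) * Y
    ∑-countStartingIn-old = +-cancelʳ-≡ Y _ _ (begin
      ∑ (upTo c) (countStartingIn Q W) + Y
        ≡⟨ ∑-upTo-doubled-but-one c pb (countStartingIn Q W) settles X Y (prev-opened pos)
             countStartingIn-other (pending-after-prev pos) countStartingIn-prev ⟩
      count settles (upTo c) * (X + X) + count (not ∘ settles) (upTo c) * (Y + Y)
        ≡⟨ cong₂ (λ u v → u * (X + X) + v * (Y + Y)) (sym (numPending≡count-settled pos)) count-not-settles ⟩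
      o * (X + X) + suc a * (Y + Y)
        ≡⟨ solve 4 (λ o x a y → o :* (x :+ x) :+ (con 1 :+ a) :* (y :+ y)
                                := o :* (x :+ x) :+ (con 1 :+ con 2 :* a) :* y :+ y)
                 refl o X a Y ⟩
      o * (X + X) + suc (2 * a) * Y + Y ∎)
      where open ≡-Reasoning

    count-new : count (λ w → canonicalFrom (suc c) w ∧ constraint c first last p (pb , ps) ((c , true) ∷ w)) W
                ≡ M a (suc o)
    count-new = begin
      count (λ w → canonicalFrom (suc c) w ∧ constraint c first last p (pb , ps) ((c , true) ∷ w)) W
        ≡⟨ count-cong W (λ w → accepts-new c first last p ps w (prev-opened pos)) ⟩
      count (accepts (suc c) first′ last′ (suc p) (c , true)) W
        ≡⟨ IH true a (Positions-new pos) (subst (_≤ m) (+-suc c l) c+l<m) c+1≡1+a+o′ ⟩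
      M a (numPending (suc c) first′ last′)
        ≡⟨ cong (M a) (numPending-new pos) ⟩
      M a (suc o) ∎
      where
      open ≡-Reasoning
      first′ = noteFirst first c (suc p)
      last′ = noteLast last c (suc p)
      c+1≡1+a+o′ : suc c ≡ suc (a + numPending (suc c) first′ last′)
      c+1≡1+a+o′ = cong suc (trans c≡1+a+o (trans (sym (+-suc a o)) (cong (a +_) (sym (numPending-new pos)))))

    counted : count Q (wordsOf m (suc l)) ≡ mergingFreeWays j (suc l) a o
    counted = begin
      count Q (wordsOf m (suc l))
        ≡⟨ count-canonical-wordsOf-suc m l c (constraint c first last p (pb , ps))
                                        (<-≤-trans (m<m+n c (s≤s z≤n)) c+l<m) ⟩
      ∑ (upTo c) (countStartingIn Q W) + _
        ≡⟨ cong₂ _+_ ∑-countStartingIn-old count-new ⟩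
      o * (X + X) + suc (2 * a) * Y + M a (suc o)
        ≡⟨ solve 5 (λ o x a y z → o :* (x :+ x) :+ (con 1 :+ con 2 :* a) :* y :+ z
                                  := z :+ (o :* (con 2 :* x) :+ (con 1 :+ con 2 :* a) :* y))
                 refl o X a Y (M a (suc o)) ⟩
      mergingFreeWays j (suc l) a o ∎
      where open ≡-Reasoning

  count-accepts : ∀ m l → Counted m l
  count-accepts m zero = count-accepts-zero m
  count-accepts m (suc l) ps a pos c+l<m c≡1+a+o = Step.counted (count-accepts m l) ps a pos c+l<m c≡1+a+o

  mergingFreeSeparatedCount≡mergingFreeWays : ∀ l →
    mergingFreeSeparatedCount (suc l) (suc j) ≡ mergingFreeWays j l 0 0
  mergingFreeSeparatedCount≡mergingFreeWays l = begin
    mergingFreeSeparatedCount n (suc j)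
      ≡⟨ countWhere-partitionsB P n ⟩
    count (λ w → canonical w ∧ P w) (wordsOf n (suc l))
      ≡⟨ count-canonical-wordsOf-suc n l 0 P (s≤s z≤n) ⟩
    count (λ w → canonicalFrom 1 w ∧ P ((0 , true) ∷ w)) (wordsOf n l)
      ≡⟨ count-cong (wordsOf n l) first-letter ⟩
    count (accepts 1 first₁ last₁ 1 (0 , true)) (wordsOf n l)
      ≡⟨ count-accepts n l true 0 pos₁ ≤-refl refl ⟩
    mergingFreeWays j l 0 0 ∎
    where
    open ≡-Reasoning
    n = suc l
    P : Word → Bool
    P w = (numBlocks w ≡ᵇ suc j) ∧ mergingFree w ∧ separated w
    first₁ last₁ : ℕ → ℕ
    first₁ = noteFirst (λ _ → 0) 0 1
    last₁ = noteLast (λ _ → 0) 0 1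
    first-letter : ∀ w → canonicalFrom 1 w ∧ P ((0 , true) ∷ w) ≡ accepts 1 first₁ last₁ 1 (0 , true) w
    first-letter w = cong₂ (λ x y → canonicalFrom 1 w ∧ ((blocksFrom 1 w ≡ᵇ suc j) ∧ (x ∧ not y)))
      (trans (mergingFree≡mergingFreeFrom ((0 , true) ∷ w))
             (mergingFreeFrom-∷ 0 (λ _ → 0) (λ _ → 0) 0 0 true w))
      (hasSuccession≡hasSuccessionAfter (0 , true) w)
    pos₁ : Positions 1 first₁ last₁ 1 0
    pos₁ = record
      { first-opened = λ { zero _ → s≤s z≤n ; (suc i) (s≤s ()) }
      ; first-unopened = λ { zero () ; (suc i) _ → refl }
      ; first≤ = λ { zero → ≤-refl ; (suc i) → z≤n }
      ; last≤ = λ { zero → ≤-refl ; (suc i) → z≤n }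
      ; prev-opened = s≤s z≤n
      ; last-prev = refl }

mainTheorem11 : (n k : ℕ) → 1 ≤ n → 1 ≤ k →
    mergingFreeSeparatedCount n k ≡ nonSingletonCount (n ∸ 1) (k ∸ 1)
mainTheorem11 (suc l) (suc j) _ _ = begin
  mergingFreeSeparatedCount (suc l) (suc j)
    ≡⟨ MergingFreeSeparated.mergingFreeSeparatedCount≡mergingFreeWays j l ⟩
  mergingFreeWays j l 0 0
    ≡⟨ sym (nonSingletonWays≡binomialSum j l 0 0) ⟩
  nonSingletonWays j l 0 0
    ≡⟨ sym (NonSingletons.nonSingletonCount≡nonSingletonWays j l) ⟩
  nonSingletonCount l j ∎
  where open ≡-Reasoning
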